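{- $\mathrm{PSSPM} \subsetneq \mathrm{SSPM}$, where $\mathrm{PSSPM}=\bigcup_{n\in\mathbb N}\mathrm{PSSPM}(n)$ and $\mathrm{SSPM}=\bigcup_{n\in\mathbb N}\mathrm{SSPM}(n)$.
   Context: A configuration is a sequence $c=(c_i)_{i\in\mathbb Z}$ of nonnegative integers with only finitely many nonzero terms. The initial configuration $(\underline{n})$ is given by $c_0=n$ and $c_i=0$ for $i\neq 0$. There are two local rules. - Rule $\mathcal L$ at column $i$ is applicable when $a_{i-1}+2\le a_i$. It decreases $a_i$ by 1 and increases $a_{i-1}$ by 1. - Rule $\mathcal R$ at column $i$ is applicable when $a_i\ge a_{i+1}+2$. It decreases $a_i$ by 1 and increases $a_{i+1}$ by 1. The two global dynamics are as follows. - SSPM: one step applies exactly one applicable local rule at one column. - PSSPM: one step applies, simultaneously, at every column where at least one local rule is applicable, exactly one applicable local rule. Where both are applicable, either one may be chosen. SSPM($n$) (resp. PSSPM($n$)) is the set of configurations reachable from $(\underline{n})$ by finitely many steps of the respective dynamics. -}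

module Defs where

open import Data.Nat using (ℕ; zero; suc; _+_; _≤_)
open import Data.Integer using (ℤ; +_; _≟_)
import Data.Integer as ℤ

prev next : ℤ → ℤ
prev i = i ℤ.- + 1
next i = i ℤ.+ + 1
open import Data.Product using (Σ; ∃; _×_; _,_)
open import Data.Sum using (_⊎_)
open import Relation.Nullary using (¬_; yes; no)
open import Relation.Binary.PropositionalEquality using (_≡_)

-- A configuration: a map ℤ → ℕ (column i ↦ number of grains a_i).
-- Finite support is guaranteed for all reachable configurations; sets of
-- configurations are compared pointwise (extensionally).
Config : Set
Config = ℤ → ℕ

_≈_ : Config → Config → Set
c ≈ d = ∀ i → c i ≡ d i

initial : ℕ → Config
initial n i with i ≟ + 0
... | yes _ = n
... | no  _ = 0

L-app : Config → ℤ → Set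
L-app c i = c (prev i) + 2 ≤ c i

R-app : Config → ℤ → Set
R-app c i = c (next i) + 2 ≤ c i

move : Config → ℤ → ℤ → Config → Set
move c i j d =
  (d i + 1 ≡ c i) × (d j ≡ suc (c j)) × (∀ k → ¬ (k ≡ i) → ¬ (k ≡ j) → d k ≡ c k)

SSPMStep : Config → Config → Set
SSPMStep c d = ∃ λ i →
  (L-app c i × move c i (prev i) d) ⊎ (R-app c i × move c i (next i) d)

data Act : Set where
  none fireL fireR : Act

-- The action is legal: fire an applicable rule, and fire whenever some rule is applicable
Legal : Config → ℤ → Act → Set
Legal c i none  = ¬ L-app c i × ¬ R-app c i
Legal c i fireL = L-app c i
Legal c i fireR = R-app c i

out : Act → ℕ
out none = 0
out fireL = 1
out fireR = 1

inL : Act → ℕ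
inL fireL = 1
inL _ = 0

inR : Act → ℕ
inR fireR = 1
inR _ = 0

-- one PSSPM step: a legal action at every column, applied simultaneously.
-- column j loses a grain if it fires, gains one if column j+1 fires L,
-- gains one if column j-1 fires R.
PSSPMStep : Config → Config → Set
PSSPMStep c d = Σ (ℤ → Act) λ act →
  (∀ i → Legal c i (act i)) ×
  (∀ j → d j + out (act j) ≡ c j + inL (act (next j)) + inR (act (prev j)))

data Reach (Step : Config → Config → Set) (s : Config) : Config → Set where
  here : ∀ {c} → s ≈ c → Reach Step s c
  step : ∀ {c d} → Reach Step s c → Step c d → Reach Step s d

SSPMn : ℕ → Config → Set
SSPMn n = Reach SSPMStep (initial n)

PSSPMn : ℕ → Config → Set
PSSPMn n = Reach PSSPMStep (initial n)

SSPM : Config → Set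
SSPM c = ∃ λ n → SSPMn n c

PSSPM : Config → Set
PSSPM c = ∃ λ n → PSSPMn n c

-- A parallel step fires a set of columns simultaneously.  We perform the same
-- firings one column at a time from left to right ("stages" of the schedule).  Each single
-- firing is a legal sequential move provided the configuration has no valley, i.e. no
-- column i firing R while column i+2 fires L into the same hole.  Valley-freeness follows
-- from unimodality, which every parallel step preserves, and finitely many stages suffice
-- because reachable configurations have finite support.  So "unimodal, finitely supported
-- and in SSPM(n)" is an invariant of PSSPM(n), proved by induction on reachability.
--
-- After any parallel step from a valley-free configuration, a column with at
-- least 3 grains and an empty left neighbour is not followed by a higher column: the empty
-- neighbour forces the column to have fired R.  The pair (3,4), obtained from (7) by three
-- sequential L-moves, violates this and is not the initial configuration.
module Submission where

open import Defs
open import Data.Empty using (⊥; ⊥-elim)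
open import Data.Nat using (ℕ; zero; suc; _+_; _∸_; _≤_; z≤n; s≤s)
open import Data.Nat.Properties
  using ( ≤-refl; ≤-trans; <⇒≤; ≤-reflexive; ≤-pred; ≰⇒>; <-irrefl; m<m+n; m≤m+n; m≤n+m
        ; m+n≤o⇒m≤o; +-mono-≤; +-monoˡ-≤; +-cancelʳ-≤; +-identityʳ; +-comm; +-assoc
        ; m∸n≤m; m∸n+n≡m; m+n∸n≡m; +-∸-assoc; n≤0⇒n≡0; m+n≡0⇒m≡0; m+n≡0⇒n≡0
        ; _≤?_
        ; module ≤-Reasoning)
open import Data.Integer as ℤ using (ℤ; +_; -[1+_])
import Data.Integer.Properties as ℤP
open import Data.Integer.Tactic.RingSolver using (solve-∀)
open import Data.Product using (_×_; ∃; _,_; proj₁; proj₂)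
open import Data.Sum using (_⊎_; inj₁; inj₂)
open import Function using (_∘_)
open import Relation.Nullary using (¬_; yes; no; contradiction)
open import Relation.Binary.PropositionalEquality

next≡suc : ∀ i → next i ≡ ℤ.suc i
next≡suc i = ℤP.+-comm i (+ 1)

prev≡pred : ∀ i → prev i ≡ ℤ.pred i
prev≡pred i = ℤP.+-comm i (-[1+ 0 ])

next-prev : ∀ i → next (prev i) ≡ i
next-prev i = trans (next≡suc (prev i)) (trans (cong ℤ.suc (prev≡pred i)) (ℤP.suc-pred i))

prev-next : ∀ i → prev (next i) ≡ i
prev-next i = trans (prev≡pred (next i)) (trans (cong ℤ.pred (next≡suc i)) (ℤP.pred-suc i))

<next : ∀ i → i ℤ.< next i
<next i = ℤP.suc[i]≤j⇒i<j (ℤP.≤-reflexive (sym (next≡suc i)))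

prev< : ∀ i → prev i ℤ.< i
prev< i = subst (prev i ℤ.<_) (next-prev i) (<next (prev i))

<⇒next≤ : ∀ {i j} → i ℤ.< j → next i ℤ.≤ j
<⇒next≤ {i} i<j = subst (ℤ._≤ _) (sym (next≡suc i)) (ℤP.i<j⇒suc[i]≤j i<j)

<⇒≤prev : ∀ {i j} → i ℤ.< j → i ℤ.≤ prev j
<⇒≤prev {i} {j} i<j = subst (i ℤ.≤_) (sym (prev≡pred j)) (ℤP.i<j⇒i≤pred[j] i<j)

<next⇒≤ : ∀ {i j} → i ℤ.< next j → i ℤ.≤ j
<next⇒≤ {i} {j} i<nj = subst (i ℤ.≤_) (prev-next j) (<⇒≤prev i<nj)

below-or-above : ∀ i j → i ℤ.< j ⊎ j ℤ.≤ i
below-or-above i j with i ℤP.<? j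
... | yes i<j = inj₁ i<j
... | no i≮j = inj₂ (ℤP.≮⇒≥ i≮j)

next≢ : ∀ i → next i ≢ i
next≢ i = ≢-sym (ℤP.<⇒≢ (<next i))

prev≢ : ∀ i → prev i ≢ i
prev≢ i = ℤP.<⇒≢ (prev< i)

widen : ∀ lo m → prev lo ℤ.+ + suc (suc m) ≡ next (lo ℤ.+ + m)
widen lo m = shift lo (+ m)
  where
  shift : ∀ (lo x : ℤ) → (lo ℤ.- + 1) ℤ.+ (+ 2 ℤ.+ x) ≡ (lo ℤ.+ x) ℤ.+ + 1
  shift = solve-∀

no-climb : ∀ {x y} → x + 2 ≤ y → ¬ y ≤ x
no-climb {x} x+2≤y y≤x = <-irrefl refl (≤-trans (m<m+n x (s≤s z≤n)) (≤-trans x+2≤y y≤x))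

-- The arithmetic core of comparing two neighbours before and after a step: one of them
-- changes by at most o, the other loses at most o, and they were 2·o apart.
transfer : ∀ {dj cj ck dk} o → dj ≤ cj + o → cj + o + o ≤ ck → ck ≤ dk + o → dj ≤ dk
transfer {dj} {cj} {ck} {dk} o dj≤ apart ck≤ = +-cancelʳ-≤ o dj dk (begin
  dj + o      ≤⟨ +-monoˡ-≤ o dj≤ ⟩
  cj + o + o  ≤⟨ apart ⟩
  ck          ≤⟨ ck≤ ⟩
  dk + o      ∎)
  where open ≤-Reasoning

∸-suc : ∀ {m m' o} → m' ≡ suc m → o ≤ m → m' ∸ o ≡ suc (m ∸ o)
∸-suc refl o≤m = +-∸-assoc 1 o≤m

move-≈ : ∀ {c i j d d'} → move c i j d → d ≈ d' → move c i j d'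
move-≈ {i = i} {j} (source , target , rest) d≈d' =
  trans (cong (_+ 1) (sym (d≈d' i))) source ,
  trans (sym (d≈d' j)) target ,
  λ k k≢i k≢j → trans (sym (d≈d' k)) (rest k k≢i k≢j)

SSPMStep-≈ : ∀ {c d d'} → SSPMStep c d → d ≈ d' → SSPMStep c d'
SSPMStep-≈ (i , inj₁ (l , m)) d≈d' = i , inj₁ (l , move-≈ m d≈d')
SSPMStep-≈ (i , inj₂ (r , m)) d≈d' = i , inj₂ (r , move-≈ m d≈d')

reach-≈ : ∀ {s c c'} → Reach SSPMStep s c → c ≈ c' → Reach SSPMStep s c'
reach-≈ (here s≈c) c≈c' = here (λ i → trans (s≈c i) (c≈c' i))
reach-≈ (step r st) c≈c' = step r (SSPMStep-≈ st c≈c')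

fireL⇒≢R : ∀ {a} → a ≡ fireL → a ≢ fireR
fireL⇒≢R refl ()

fireR⇒≢L : ∀ {a} → a ≡ fireR → a ≢ fireL
fireR⇒≢L refl ()

inR-idle : ∀ {a} → a ≢ fireR → inR a ≡ 0
inR-idle {none} _ = refl
inR-idle {fireL} _ = refl
inR-idle {fireR} a≢R = ⊥-elim (a≢R refl)

inL-idle : ∀ {a} → a ≢ fireL → inL a ≡ 0
inL-idle {none} _ = refl
inL-idle {fireL} a≢L = ⊥-elim (a≢L refl)
inL-idle {fireR} _ = refl

out≤1 : ∀ a → out a ≤ 1
out≤1 none = z≤n
out≤1 fireL = s≤s z≤n
out≤1 fireR = s≤s z≤n

inL≤1 : ∀ a → inL a ≤ 1
inL≤1 none = z≤n
inL≤1 fireL = s≤s z≤n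
inL≤1 fireR = z≤n

two-grains : ∀ {x y} → x + 2 ≤ y → 2 ≤ y
two-grains {x} = ≤-trans (m≤n+m 2 x)

2≰1 : ¬ 2 ≤ 1
2≰1 (s≤s ())

3≰2 : ¬ 3 ≤ 2
3≰2 (s≤s (s≤s ()))

out≤ : ∀ {c i} a → Legal c i a → out a ≤ c i
out≤ none _ = z≤n
out≤ fireL l = m+n≤o⇒m≤o 1 (two-grains l)
out≤ fireR r = m+n≤o⇒m≤o 1 (two-grains r)

silent : ∀ {c i} a → Legal c i a → c i ≤ 1 → a ≡ none
silent none _ _ = refl
silent fireL l ci≤1 = ⊥-elim (2≰1 (≤-trans (two-grains l) ci≤1))
silent fireR r ci≤1 = ⊥-elim (2≰1 (≤-trans (two-grains r) ci≤1))

leftward : ∀ {c k} a → a ≢ fireR → Legal c (next k) a → c k ≤ c (next k) →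
           inL a ≡ out a × c k + out a + out a ≤ c (next k)
leftward {c} {k} none _ _ up =
  refl , subst (_≤ c (next k)) (sym (trans (+-identityʳ _) (+-identityʳ _))) up
leftward {c} {k} fireL _ l _ =
  refl , subst (_≤ c (next k)) (sym (+-assoc (c k) 1 1))
               (subst (λ x → c x + 2 ≤ c (next k)) (prev-next k) l)
leftward fireR a≢R _ _ = ⊥-elim (a≢R refl)

rightward : ∀ {c k} a → a ≢ fireL → Legal c k a → c (next k) ≤ c k →
            inR a ≡ out a × c (next k) + out a + out a ≤ c k
rightward {c} {k} none _ _ down =
  refl , subst (_≤ c k) (sym (trans (+-identityʳ _) (+-identityʳ _))) down
rightward fireL a≢L _ _ = ⊥-elim (a≢L refl)
rightward {c} {k} fireR _ r _ = refl , subst (_≤ c k) (sym (+-assoc (c (next k)) 1 1)) r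

AscendsTo DescendsFrom : ℤ → Config → Set
AscendsTo p c = ∀ j → j ℤ.< p → c j ≤ c (next j)
DescendsFrom p c = ∀ j → p ℤ.≤ j → c (next j) ≤ c j

Unimodal : Config → Set
Unimodal c = ∃ λ p → AscendsTo p c × DescendsFrom p c

NoValley : Config → Set
NoValley c = ∀ i → R-app c i → L-app c (next (next i)) → ⊥

Supported : Config → Set
Supported c = ∃ λ lo → ∃ λ m →
  (∀ i → i ℤ.≤ lo → c i ≡ 0) × (∀ i → lo ℤ.+ + m ℤ.≤ i → c i ≡ 0)

EdgeDescends : Config → Set
EdgeDescends c = ∀ i → c (prev i) ≡ 0 → 3 ≤ c i → c (next i) ≤ c i

-- Valleys need a drop right of the peak followed by a rise left of it, so unimodal
-- configurations have none.
unimodal⇒noValley : ∀ {c} → Unimodal c → NoValley c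
unimodal⇒noValley {c} (p , asc , desc) i r l =
  ℤP.<-irrefl refl (ℤP.≤-<-trans p≤i (ℤP.<-trans (<next i) ni<p))
  where
  p≤i : p ℤ.≤ i
  p≤i = ℤP.≮⇒≥ (λ i<p → no-climb r (asc i i<p))
  rise : c (next i) + 2 ≤ c (next (next i))
  rise = subst (λ x → c x + 2 ≤ c (next (next i))) (prev-next (next i)) l
  ni<p : next i ℤ.< p
  ni<p = ℤP.≰⇒> (λ p≤ni → no-climb rise (desc (next i) p≤ni))

extend-asc : ∀ {q c} → AscendsTo q c → c q ≤ c (next q) → AscendsTo (next q) c
extend-asc {q} {c} asc up j j<nq with j ℤP.≟ q
... | yes refl = up
... | no j≢q = asc j (ℤP.≤∧≢⇒< (<next⇒≤ j<nq) j≢q)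

extend-desc : ∀ {q c} → DescendsFrom (next q) c → c (next q) ≤ c q → DescendsFrom q c
extend-desc {q} {c} desc down j q≤j with q ℤP.≟ j
... | yes refl = down
... | no q≢j = desc j (<⇒next≤ (ℤP.≤∧≢⇒< q≤j q≢j))

peak : ∀ {q c} → AscendsTo q c → DescendsFrom (next q) c → Unimodal c
peak {q} {c} asc desc with c (next q) ≤? c q
... | yes down = q , asc , extend-desc desc down
... | no ¬down = next q , extend-asc asc (<⇒≤ (≰⇒> ¬down)) , desc

apply : (ℤ → Act) → Config → Config
apply a c j = (c j + inL (a (next j)) + inR (a (prev j))) ∸ out (a j)

apply-cong : ∀ {a b} → (∀ j → a j ≡ b j) → ∀ c → apply a c ≈ apply b c
apply-cong a≡b c j rewrite a≡b j | a≡b (next j) | a≡b (prev j) = refl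

apply-idle : ∀ {a} → (∀ j → a j ≡ none) → ∀ c → apply a c ≈ c
apply-idle idle c j rewrite idle j | idle (next j) | idle (prev j) =
  trans (+-identityʳ _) (+-identityʳ (c j))

apply-upper : ∀ a c j → apply a c j ≤ c j + inL (a (next j)) + inR (a (prev j))
apply-upper a c j = m∸n≤m _ (out (a j))

apply-lower : ∀ {a} c j → a j ≡ none → c j ≤ apply a c j
apply-lower c j idle rewrite idle = m+n≤o⇒m≤o (c j) (m+n≤o⇒m≤o (c j + _) ≤-refl)

-- Two schedules a, a' that differ only at column p, where a is idle: performing a' instead of
-- a fires one more column, and the outcomes differ by a single grain move.
module Refine {c : Config} {a a' : ℤ → Act} {p : ℤ}
  (agree : ∀ j → j ≢ p → a' j ≡ a j) (idle : a p ≡ none) where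

  inL-agree : a' p ≢ fireL → ∀ j → inL (a' j) ≡ inL (a j)
  inL-agree notL j with j ℤP.≟ p
  ... | yes refl rewrite idle = inL-idle notL
  ... | no j≢p = cong inL (agree j j≢p)

  inR-agree : a' p ≢ fireR → ∀ j → inR (a' j) ≡ inR (a j)
  inR-agree notR j with j ℤP.≟ p
  ... | yes refl rewrite idle = inR-idle notR
  ... | no j≢p = cong inR (agree j j≢p)

  fire-L : a' p ≡ fireL → 1 ≤ c p → out (a (prev p)) ≤ c (prev p) →
           move (apply a c) p (prev p) (apply a' c)
  fire-L firesL 1≤cp paid = source , target , rest
    where
    source : apply a' c p + 1 ≡ apply a c p
    source rewrite agree (next p) (next≢ p) | agree (prev p) (prev≢ p) | firesL | idle =
      m∸n+n≡m (≤-trans 1≤cp (m+n≤o⇒m≤o (c p) (m≤m+n (c p + _) _)))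
    target : apply a' c (prev p) ≡ suc (apply a c (prev p))
    target rewrite agree (prev p) (prev≢ p) | inR-agree (fireL⇒≢R firesL) (prev (prev p))
                 | next-prev p | firesL | idle =
      ∸-suc (cong (_+ inR (a (prev (prev p))))
                  (trans (+-comm (c (prev p)) 1) (cong suc (sym (+-identityʳ _)))))
            (≤-trans paid (≤-trans (m≤m+n (c (prev p)) 0) (m≤m+n (c (prev p) + 0) _)))
    rest : ∀ k → k ≢ p → k ≢ prev p → apply a' c k ≡ apply a c k
    rest k k≢p k≢pp =
      cong₂ _∸_ (cong₂ _+_ (cong (_+_ (c k)) (cong inL (agree (next k) nk≢p)))
                           (inR-agree (fireL⇒≢R firesL) (prev k)))
                (cong out (agree k k≢p))
      where
      nk≢p : next k ≢ p
      nk≢p e = k≢pp (trans (sym (prev-next k)) (cong prev e))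

  fire-R : a' p ≡ fireR → 1 ≤ c p → out (a (next p)) ≤ c (next p) →
           move (apply a c) p (next p) (apply a' c)
  fire-R firesR 1≤cp paid = source , target , rest
    where
    source : apply a' c p + 1 ≡ apply a c p
    source rewrite agree (next p) (next≢ p) | agree (prev p) (prev≢ p) | firesR | idle =
      m∸n+n≡m (≤-trans 1≤cp (m+n≤o⇒m≤o (c p) (m≤m+n (c p + _) _)))
    target : apply a' c (next p) ≡ suc (apply a c (next p))
    target rewrite agree (next p) (next≢ p) | inL-agree (fireR⇒≢L firesR) (next (next p))
                 | prev-next p | firesR | idle =
      ∸-suc (trans (+-comm (c (next p) + inL (a (next (next p)))) 1) (cong suc (sym (+-identityʳ _))))
            (≤-trans paid (≤-trans (m≤m+n (c (next p)) _) (m≤m+n _ 0)))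
    rest : ∀ k → k ≢ p → k ≢ next p → apply a' c k ≡ apply a c k
    rest k k≢p k≢np =
      cong₂ _∸_ (cong₂ _+_ (cong (_+_ (c k)) (inL-agree (fireR⇒≢L firesR) (next k)))
                           (cong inR (agree (prev k) pk≢p)))
                (cong out (agree k k≢p))
      where
      pk≢p : prev k ≢ p
      pk≢p e = k≢np (trans (sym (next-prev k)) (cong next e))

upTo : ℤ → (ℤ → Act) → ℤ → Act
upTo p a j with j ℤP.<? p
... | yes _ = a j
... | no _ = none

upTo-below : ∀ {p j} a → j ℤ.< p → upTo p a j ≡ a j
upTo-below {p} {j} a j<p with j ℤP.<? p
... | yes _ = refl
... | no j≮p = ⊥-elim (j≮p j<p)

upTo-above : ∀ {p j} a → p ℤ.≤ j → upTo p a j ≡ none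
upTo-above {p} {j} a p≤j with j ℤP.<? p
... | yes j<p = ⊥-elim (ℤP.<-irrefl refl (ℤP.<-≤-trans j<p p≤j))
... | no _ = refl

upTo-out : ∀ p a j → out (upTo p a j) ≤ out (a j)
upTo-out p a j with j ℤP.<? p
... | yes _ = ≤-refl
... | no _ = z≤n

upTo-next : ∀ {p j} a → j ≢ p → upTo (next p) a j ≡ upTo p a j
upTo-next {p} {j} a j≢p with j ℤP.<? p
... | yes j<p = upTo-below a (ℤP.<-trans j<p (<next p))
... | no j≮p = upTo-above a (<⇒next≤ (ℤP.≤∧≢⇒< (ℤP.≮⇒≥ j≮p) (≢-sym j≢p)))

upTo-idle : ∀ {p a} → (∀ j → j ℤ.< p → a j ≡ none) → ∀ j → upTo p a j ≡ none
upTo-idle {p} {a} idle j with below-or-above j p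
... | inj₁ j<p = trans (upTo-below a j<p) (idle j j<p)
... | inj₂ p≤j = upTo-above a p≤j

upTo-all : ∀ {p a} → (∀ j → p ℤ.≤ j → a j ≡ none) → ∀ j → upTo p a j ≡ a j
upTo-all {p} {a} idle j with below-or-above j p
... | inj₁ j<p = upTo-below a j<p
... | inj₂ p≤j = trans (upTo-above a p≤j) (sym (idle j p≤j))

fireR? : ∀ a → a ≡ fireR ⊎ a ≢ fireR
fireR? none = inj₂ (λ ())
fireR? fireL = inj₂ (λ ())
fireR? fireR = inj₁ refl

module StepFacts {c d : Config} (st : PSSPMStep c d) where

  act : ℤ → Act
  act = proj₁ st

  legal : ∀ i → Legal c i (act i)
  legal = proj₁ (proj₂ st)

  balance : ∀ j → d j + out (act j) ≡ c j + inL (act (next j)) + inR (act (prev j))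
  balance = proj₂ (proj₂ st)

  fires-L : ∀ {j} → act j ≡ fireL → L-app c j
  fires-L {j} e = subst (Legal c j) e (legal j)

  fires-R : ∀ {j} → act j ≡ fireR → R-app c j
  fires-R {j} e = subst (Legal c j) e (legal j)

  idle-at-empty : ∀ j → c j ≡ 0 → act j ≡ none
  idle-at-empty j cj≡0 = silent (act j) (legal j) (subst (_≤ 1) (sym cj≡0) z≤n)

  gain : ∀ j → d j ≤ c j + inL (act (next j)) + inR (act (prev j))
  gain j = subst (d j ≤_) (balance j) (m≤m+n (d j) (out (act j)))

  loss : ∀ j → c j ≤ d j + out (act j)
  loss j = m+n≤o⇒m≤o (c j) (m+n≤o⇒m≤o (c j + _) (≤-reflexive (sym (balance j))))

  outcome : apply act c ≈ d
  outcome j = trans (cong (_∸ out (act j)) (sym (balance j))) (m+n∸n≡m (d j) (out (act j)))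

  ascent : ∀ j → c j ≤ c (next j) → act (prev j) ≢ fireR → act (next j) ≢ fireR →
           d j ≤ d (next j)
  ascent j up noRˡ noRʳ = transfer (out a) d≤ (proj₂ sent) (loss (next j))
    where
    open ≤-Reasoning
    a : Act
    a = act (next j)
    sent : inL a ≡ out a × c j + out a + out a ≤ c (next j)
    sent = leftward a noRʳ (legal (next j)) up
    d≤ : d j ≤ c j + out a
    d≤ = begin
      d j                               ≤⟨ gain j ⟩
      c j + inL a + inR (act (prev j))
        ≡⟨ cong₂ (λ x y → c j + x + y) (proj₁ sent) (inR-idle noRˡ) ⟩
      c j + out a + 0                   ≡⟨ +-identityʳ _ ⟩
      c j + out a                       ∎

  descent : ∀ j → c (next j) ≤ c j → act (next (next j)) ≢ fireL → act j ≢ fireL →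
            d (next j) ≤ d j
  descent j down noLʳ noLˡ = transfer (out a) d≤ (proj₂ sent) (loss j)
    where
    open ≤-Reasoning
    a : Act
    a = act j
    sent : inR a ≡ out a × c (next j) + out a + out a ≤ c j
    sent = rightward a noLˡ (legal j) down
    d≤ : d (next j) ≤ c (next j) + out a
    d≤ = begin
      d (next j)
        ≤⟨ gain (next j) ⟩
      c (next j) + inL (act (next (next j))) + inR (act (prev (next j)))
        ≡⟨ cong₂ (λ x y → c (next j) + x + y) (inL-idle noLʳ)
                 (trans (cong (inR ∘ act) (prev-next j)) (proj₁ sent)) ⟩
      c (next j) + 0 + out a
        ≡⟨ cong (_+ out a) (+-identityʳ _) ⟩
      c (next j) + out a
        ∎

  ascending-noR : ∀ {p} → AscendsTo p c → ∀ {j} → j ℤ.< p → act j ≢ fireR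
  ascending-noR asc {j} j<p firesR = no-climb (fires-R firesR) (asc j j<p)

  descending-noL : ∀ {p} → DescendsFrom p c → ∀ {j} → p ℤ.< j → act j ≢ fireL
  descending-noL desc {j} p<j firesL =
    no-climb (fires-L firesL)
             (subst (λ x → c x ≤ c (prev j)) (next-prev j) (desc (prev j) (<⇒≤prev p<j)))

  ascends-left : ∀ {p} → AscendsTo p c → AscendsTo (prev p) d
  ascends-left {p} asc j j<pp =
    ascent j (asc j j<p) (ascending-noR asc (ℤP.<-trans (prev< j) j<p)) (ascending-noR asc nj<p)
    where
    j<p : j ℤ.< p
    j<p = ℤP.<-trans j<pp (prev< p)
    nj<p : next j ℤ.< p
    nj<p = ℤP.≤-<-trans (<⇒next≤ j<pp) (prev< p)

  descends-right : ∀ {p} → DescendsFrom p c → DescendsFrom (next p) d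
  descends-right {p} desc j np≤j =
    descent j (desc j (ℤP.<⇒≤ p<j)) (descending-noL desc p<nnj) (descending-noL desc p<j)
    where
    p<j : p ℤ.< j
    p<j = ℤP.<-≤-trans (<next p) np≤j
    p<nnj : p ℤ.< next (next j)
    p<nnj = ℤP.<-trans p<j (ℤP.<-trans (<next j) (<next (next j)))

  -- Unimodality is preserved: away from the peak p monotonicity survives, and at the peak
  -- the firing of column p decides whether the new peak lies left or right of it.
  unimodal-step : Unimodal c → Unimodal d
  unimodal-step (p , asc , desc) = around-peak (fireR? (act p))
    where
    around-peak : act p ≡ fireR ⊎ act p ≢ fireR → Unimodal d
    around-peak (inj₁ firesR) =
      peak (ascends-left asc)
           (subst (λ q → DescendsFrom q d) (sym (next-prev p)) (extend-desc (descends-right desc) down))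
      where
      down : d (next p) ≤ d p
      down = descent p (desc p ℤP.≤-refl)
                     (descending-noL desc (ℤP.<-trans (<next p) (<next (next p))))
                     (fireR⇒≢L firesR)
    around-peak (inj₂ notR) =
      peak (subst (λ q → AscendsTo q d) (next-prev p) (extend-asc (ascends-left asc) up))
           (descends-right desc)
      where
      up : d (prev p) ≤ d (next (prev p))
      up = ascent (prev p) (asc (prev p) (prev< p))
                  (ascending-noR asc (ℤP.<-trans (prev< (prev p)) (prev< p)))
                  (subst (λ x → act x ≢ fireR) (sym (next-prev p)) notR)

  emptied : ∀ j → d j ≡ 0 → act j ≡ none × c j ≡ 0 × inL (act (next j)) ≡ 0
  emptied j dj≡0 = idle , m+n≡0⇒m≡0 (c j) total≡0 , m+n≡0⇒n≡0 (c j) total≡0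
    where
    open ≤-Reasoning
    received : c j + inL (act (next j)) ≤ out (act j)
    received = begin
      c j + inL (act (next j))                        ≤⟨ m≤m+n _ _ ⟩
      c j + inL (act (next j)) + inR (act (prev j))   ≡⟨ sym (balance j) ⟩
      d j + out (act j)                               ≡⟨ cong (_+ out (act j)) dj≡0 ⟩
      out (act j)                                     ∎
    idle : act j ≡ none
    idle = silent (act j) (legal j) (m+n≤o⇒m≤o (c j) (≤-trans received (out≤1 (act j))))
    total≡0 : c j + inL (act (next j)) ≡ 0
    total≡0 = n≤0⇒n≡0 (subst (λ a → c j + inL (act (next j)) ≤ out a) idle received)

  -- After a step from a valley-free configuration, a column with an empty left neighbour and
  -- at least 3 grains must have fired R, hence it is not followed by a higher column.
  descends-at-edge : NoValley c → EdgeDescends d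
  descends-at-edge noValley i left≡0 3≤di = by-action (act i) refl (legal i)
    where
    left : act (prev i) ≡ none × c (prev i) ≡ 0 × inL (act (next (prev i))) ≡ 0
    left = emptied (prev i) left≡0
    by-action : ∀ a → act i ≡ a → Legal c i a → d (next i) ≤ d i
    by-action none _ (noL , _) = ⊥-elim (3≰2 (≤-trans 3≤di (≤-trans (gain i) small)))
      where
      ci≤1 : c i ≤ 1
      ci≤1 = ≤-pred (≰⇒> λ 2≤ci →
               noL (subst (λ x → x + 2 ≤ c i) (sym (proj₁ (proj₂ left))) 2≤ci))
      small : c i + inL (act (next i)) + inR (act (prev i)) ≤ 2
      small = +-mono-≤ (+-mono-≤ ci≤1 (inL≤1 _)) (≤-reflexive (cong inR (proj₁ left)))
    by-action fireL firesL _ =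
      contradiction (trans (cong inL (sym firesL))
                           (trans (cong (inL ∘ act) (sym (next-prev i))) (proj₂ (proj₂ left))))
                    (λ ())
    by-action fireR firesR r =
      descent i (≤-trans (m≤m+n _ 2) r)
                (λ firesL → noValley i r (fires-L firesL)) (fireR⇒≢L firesR)

  vanishes : ∀ j → c (prev j) ≡ 0 → c j ≡ 0 → c (next j) ≡ 0 → d j ≡ 0
  vanishes j left≡0 here≡0 right≡0 = n≤0⇒n≡0 (subst (d j ≤_) nothing (gain j))
    where
    nothing : c j + inL (act (next j)) + inR (act (prev j)) ≡ 0
    nothing rewrite here≡0 | idle-at-empty (next j) right≡0 | idle-at-empty (prev j) left≡0 = refl

  supported-step : Supported c → Supported d
  supported-step (lo , m , empty-left , empty-right) = prev lo , suc (suc m) , left , right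
    where
    left : ∀ i → i ℤ.≤ prev lo → d i ≡ 0
    left i i≤plo = vanishes i (empty-left (prev i) (ℤP.<⇒≤ (ℤP.<-trans (prev< i) i<lo)))
                              (empty-left i (ℤP.<⇒≤ i<lo)) (empty-left (next i) (<⇒next≤ i<lo))
      where
      i<lo : i ℤ.< lo
      i<lo = ℤP.≤-<-trans i≤plo (prev< lo)
    right : ∀ i → prev lo ℤ.+ + suc (suc m) ℤ.≤ i → d i ≡ 0
    right i far = vanishes i (empty-right (prev i) (<⇒≤prev hi<i)) (empty-right i (ℤP.<⇒≤ hi<i))
                             (empty-right (next i) (ℤP.<⇒≤ (ℤP.<-trans hi<i (<next i))))
      where
      hi<i : lo ℤ.+ + m ℤ.< i
      hi<i = ℤP.<-≤-trans (<next _) (subst (ℤ._≤ i) (widen lo m) far)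

  stage : ℤ → Config
  stage p = apply (upTo p act) c

  stage-pays : ∀ p j → out (upTo p act j) ≤ c j
  stage-pays p j = ≤-trans (upTo-out p act j) (out≤ (act j) (legal j))

  -- When column p is due to fire L, its left neighbour has not grown in stage p: column p
  -- has not fired yet, and column p-2 did not fire R since that would make a valley.
  stage-left≤ : NoValley c → ∀ {p} → L-app c p → stage p (prev p) ≤ c (prev p)
  stage-left≤ noValley {p} l = begin
    stage p (prev p)
      ≤⟨ apply-upper (upTo p act) c (prev p) ⟩
    c (prev p) + inL (upTo p act (next (prev p))) + inR (upTo p act (prev (prev p)))
      ≡⟨ cong₂ (λ x y → c (prev p) + x + y)
               (cong inL (upTo-above act (ℤP.≤-reflexive (sym (next-prev p)))))
               (trans (cong inR (upTo-below act (ℤP.<-trans (prev< (prev p)) (prev< p)))) noR) ⟩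
    c (prev p) + 0 + 0
      ≡⟨ trans (+-identityʳ _) (+-identityʳ _) ⟩
    c (prev p)
      ∎
    where
    open ≤-Reasoning
    nn-pp : next (next (prev (prev p))) ≡ p
    nn-pp = trans (cong next (next-prev (prev p))) (next-prev p)
    noR : inR (act (prev (prev p))) ≡ 0
    noR = inR-idle λ firesR →
            noValley (prev (prev p)) (fires-R firesR) (subst (L-app c) (sym nn-pp) l)

  -- In stage p the right neighbour of p is untouched: neither p nor p+2 has fired yet.
  stage-right≤ : ∀ p → stage p (next p) ≤ c (next p)
  stage-right≤ p = begin
    stage p (next p)
      ≤⟨ apply-upper (upTo p act) c (next p) ⟩
    c (next p) + inL (upTo p act (next (next p))) + inR (upTo p act (prev (next p)))
      ≡⟨ cong₂ (λ x y → c (next p) + x + y)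
               (cong inL (upTo-above act (ℤP.<⇒≤ (ℤP.<-trans (<next p) (<next (next p))))))
               (cong inR (upTo-above act (ℤP.≤-reflexive (sym (prev-next p))))) ⟩
    c (next p) + 0 + 0
      ≡⟨ trans (+-identityʳ _) (+-identityʳ _) ⟩
    c (next p)
      ∎
    where open ≤-Reasoning

  -- Adding the action of column p to a stage is one sequential move (or no move at all).
  -- An L-firing at p stays legal because, without valleys, column p-2 did not fire R into p-1.
  advance : NoValley c → ∀ p → SSPMStep (stage p) (stage (next p)) ⊎ stage p ≈ stage (next p)
  advance noValley p = by-action (act p) refl (legal p)
    where
    unscheduled : upTo p act p ≡ none
    unscheduled = upTo-above act (ℤP.≤-refl {p})
    open Refine {c} {upTo p act} {upTo (next p) act} {p} (λ j → upTo-next act) unscheduled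
    scheduled : upTo (next p) act p ≡ act p
    scheduled = upTo-below act (<next p)
    -- column p has not paid yet
    column≤ : c p ≤ stage p p
    column≤ = apply-lower {upTo p act} c p unscheduled
    by-action : ∀ a → act p ≡ a → Legal c p a →
                SSPMStep (stage p) (stage (next p)) ⊎ stage p ≈ stage (next p)
    by-action none idle _ = inj₂ (apply-cong same c)
      where
      same : ∀ j → upTo p act j ≡ upTo (next p) act j
      same j with j ℤP.≟ p
      ... | yes refl = trans unscheduled (sym (trans scheduled idle))
      ... | no j≢p = sym (upTo-next act j≢p)
    by-action fireL firesL l =
      inj₁ (p , inj₁ (≤-trans (+-monoˡ-≤ 2 (stage-left≤ noValley l)) (≤-trans l column≤) ,
                      fire-L (trans scheduled firesL) (m+n≤o⇒m≤o 1 (two-grains l))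
                             (stage-pays p (prev p))))
    by-action fireR firesR r =
      inj₁ (p , inj₂ (≤-trans (+-monoˡ-≤ 2 (stage-right≤ p)) (≤-trans r column≤) ,
                      fire-R (trans scheduled firesR) (m+n≤o⇒m≤o 1 (two-grains r))
                             (stage-pays p (next p))))

  stages : NoValley c → ∀ {s} lo → Reach SSPMStep s (stage lo) →
           ∀ k → Reach SSPMStep s (stage (lo ℤ.+ + k))
  stages noValley lo r zero = subst (Reach SSPMStep _ ∘ stage) (sym (ℤP.+-identityʳ lo)) r
  stages noValley {s} lo r (suc k) =
    subst (Reach SSPMStep s ∘ stage) index (extend (advance noValley (lo ℤ.+ + k)))
    where
    index : next (lo ℤ.+ + k) ≡ lo ℤ.+ + suc k
    index = trans (ℤP.+-assoc lo (+ k) (+ 1)) (cong (λ n → lo ℤ.+ + n) (+-comm k 1))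
    extend : SSPMStep (stage (lo ℤ.+ + k)) (stage (next (lo ℤ.+ + k))) ⊎
             stage (lo ℤ.+ + k) ≈ stage (next (lo ℤ.+ + k)) →
             Reach SSPMStep s (stage (next (lo ℤ.+ + k)))
    extend (inj₁ move) = step (stages noValley lo r k) move
    extend (inj₂ same) = reach-≈ (stages noValley lo r k) same

  -- A parallel step from a valley-free, finitely supported configuration is a sequence of
  -- sequential steps: sweep the columns of the support from left to right.
  sequentialize : NoValley c → Supported c → ∀ {s} → Reach SSPMStep s c → Reach SSPMStep s d
  sequentialize noValley (lo , m , empty-left , empty-right) r =
    reach-≈ (stages noValley lo (reach-≈ r (sym ∘ start)) m) finish
    where
    start : stage lo ≈ c
    start = apply-idle (upTo-idle (λ j j<lo → idle-at-empty j (empty-left j (ℤP.<⇒≤ j<lo)))) c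
    finish : stage (lo ℤ.+ + m) ≈ d
    finish j = trans (apply-cong (upTo-all λ j hi≤j → idle-at-empty j (empty-right j hi≤j)) c j)
                     (outcome j)

module Initial {n : ℕ} {c : Config} (start : initial n ≈ c) where

  off-origin : ∀ {i} → i ≢ + 0 → c i ≡ 0
  off-origin {i} i≢0 = trans (sym (start i)) (initial-off-origin i≢0)
    where
    initial-off-origin : ∀ {i} → i ≢ + 0 → initial n i ≡ 0
    initial-off-origin {i} i≢0 with i ℤ.≟ + 0
    ... | yes i≡0 = ⊥-elim (i≢0 i≡0)
    ... | no _ = refl

  unimodal : Unimodal c
  unimodal = + 0 , ascending , descending
    where
    ascending : AscendsTo (+ 0) c
    ascending j j<0 = subst (_≤ c (next j)) (sym (off-origin (ℤP.<⇒≢ j<0))) z≤n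
    descending : DescendsFrom (+ 0) c
    descending j 0≤j =
      subst (_≤ c j) (sym (off-origin (≢-sym (ℤP.<⇒≢ (ℤP.≤-<-trans 0≤j (<next j)))))) z≤n

  supported : Supported c
  supported = -[1+ 0 ] , 2 , left , right
    where
    left : ∀ i → i ℤ.≤ -[1+ 0 ] → c i ≡ 0
    left i i≤-1 = off-origin (ℤP.<⇒≢ (ℤP.≤-<-trans i≤-1 ℤ.-<+))
    right : ∀ i → + 1 ℤ.≤ i → c i ≡ 0
    right i 1≤i = off-origin (≢-sym (ℤP.<⇒≢ (ℤP.<-≤-trans (ℤ.+<+ (s≤s z≤n)) 1≤i)))

-- The invariant of parallel reachability; its last component gives PSSPM(n) ⊆ SSPM(n).
record Invariant (n : ℕ) (c : Config) : Set where
  field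
    unimodal   : Unimodal c
    supported  : Supported c
    sequential : SSPMn n c

preserve : ∀ {n c d} → PSSPMStep c d → Invariant n c → Invariant n d
preserve st inv = record
  { unimodal   = unimodal-step unimodal
  ; supported  = supported-step supported
  ; sequential = sequentialize (unimodal⇒noValley unimodal) supported sequential
  }
  where
  open StepFacts st
  open Invariant inv

invariant : ∀ {n c} → PSSPMn n c → Invariant n c
invariant (here start) = record
  { unimodal = Initial.unimodal start ; supported = Initial.supported start ; sequential = here start }
invariant (step r st) = preserve st (invariant r)

pair : ℕ → ℕ → Config
pair a b -[1+ 0 ] = a
pair a b -[1+ suc _ ] = 0
pair a b (+ 0) = b
pair a b (+ suc _) = 0

initial≈pair : initial 7 ≈ pair 0 7
initial≈pair -[1+ 0 ] = refl
initial≈pair -[1+ suc _ ] = refl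
initial≈pair (+ 0) = refl
initial≈pair (+ suc _) = refl

shift-left : ∀ a b → a + 2 ≤ suc b → SSPMStep (pair a (suc b)) (pair (suc a) b)
shift-left a b steep = + 0 , inj₁ (steep , +-comm b 1 , refl , elsewhere)
  where
  elsewhere : ∀ k → k ≢ + 0 → k ≢ -[1+ 0 ] → pair (suc a) b k ≡ pair a (suc b) k
  elsewhere -[1+ 0 ] _ k≢-1 = ⊥-elim (k≢-1 refl)
  elsewhere -[1+ suc _ ] _ _ = refl
  elsewhere (+ 0) k≢0 _ = ⊥-elim (k≢0 refl)
  elsewhere (+ suc _) _ _ = refl

target : Config
target = pair 3 4

target-SSPM : SSPM target
target-SSPM = 7 , step (step (step (here initial≈pair) (shift-left 0 6 (s≤s (s≤s z≤n))))
                             (shift-left 1 5 (s≤s (s≤s (s≤s z≤n)))))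
                       (shift-left 2 4 (s≤s (s≤s (s≤s (s≤s z≤n)))))

-- (3, 4) is not the initial configuration, and the edge at column -1 rises.
target-not-PSSPM : ¬ PSSPM target
target-not-PSSPM (n , here start) = contradiction (start -[1+ 0 ]) (λ ())
target-not-PSSPM (n , step r st) =
  contradiction (descends-at-edge (unimodal⇒noValley (Invariant.unimodal (invariant r))) -[1+ 0 ] refl
                                  (s≤s (s≤s (s≤s z≤n))))
                (λ { (s≤s (s≤s (s≤s ()))) })
  where
  open StepFacts st

proposition1 : (∀ c → PSSPM c → SSPM c) × (∃ λ c → SSPM c × ¬ PSSPM c)
proposition1 = (λ c (n , r) → n , Invariant.sequential (invariant r)) ,
               (target , target-SSPM , target-not-PSSPM)
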